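{- Let $G$ be a pair of $d$-dimensional layer-permuted butterflies and let $0\le q\le d$. Every connected component of the $q$-dimensional sub-butterfly connectivity graph of $G$ is a complete bipartite graph.
   Context: A $d$-dimensional layer-permuted butterfly with permutation $\pi$ of $\{1,\dots,d\}$ has nodes $(i,b)$, with $i\in\{0,\dots,d\}$ the layer and $b\in\{0,1\}^d$ the label. For $1\le i\le d$ there are edges from $(i-1,b)$ to the two nodes $(i,b')$ where $b'$ agrees with $b$ except possibly in coordinate $\pi(i)$. Layer $0$ holds the inputs and layer $d$ the outputs. A pair of $d$-dimensional layer-permuted butterflies is built from such butterflies $G_1$ (permutation $\pi$) and $G_2$ (permutation $\sigma$). The output of $G_1$ with label $x$ is identified with the input of $G_2$ with label $x$, for all $x$, and layer $j$ of $G_2$ becomes layer $d+j$. Let $m=d-q$. For $b\in\{0,1\}^m$, the left sub-butterfly $b*$ is the subgraph induced by the nodes on layers $m,\dots,d$ (in $G_1$) whose label has bit $b_i$ in coordinate $\pi(i)$ for $i=1,\dots,m$. For $c=c_{q+1}\cdots c_d\in\{0,1\}^m$, the right sub-butterfly $*c$ is the subgraph induced by the nodes on layers $d,\dots,d+q$ (layers $0,\dots,q$ of $G_2$) whose label has bit $c_j$ in coordinate $\sigma(j)$ for $j=q+1,\dots,d$. The $q$-dimensional sub-butterfly connectivity graph is the simple bipartite graph whose left vertices are the $2^m$ left sub-butterflies and whose right vertices are the $2^m$ right sub-butterflies. A left vertex $b*$ and a right vertex $*c$ are adjacent iff the two sub-butterflies share at least one node on layer $d$. -}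

module Defs where

open import Data.Nat using (ℕ; _+_; _∸_; _≤_)
open import Data.Nat.Properties using (m∸n≤m; m+[n∸m]≡n)
open import Data.Fin using (Fin; inject≤; _↑ʳ_; cast)
open import Data.Fin.Permutation using (Permutation′; _⟨$⟩ʳ_)
open import Data.Bool using (Bool)
open import Data.Product using (_×_; ∃; _,_)
open import Data.Empty using (⊥)
open import Data.Sum using (_⊎_; inj₁; inj₂)
open import Relation.Binary.PropositionalEquality using (_≡_)
open import Relation.Binary.Construct.Closure.ReflexiveTransitive using (Star)

-- Coordinates 1..d of the paper are represented by Fin d (0-based): paper index i ↦ i-1.
-- A label is a bit vector {0,1}^d, i.e. a function Fin d → Bool.
Label : ℕ → Set
Label d = Fin d → Bool

-- A node of the pair of butterflies: (global layer in 0..2d, label).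
-- Layers 0..d are G₁, layers d..2d are G₂ (layer j of G₂ is d+j); the output of
-- G₁ with label x and input of G₂ with label x are the same node (d , x).
Node : ℕ → Set
Node d = ℕ × Label d

module SubButterflies (d q : ℕ) (q≤d : q ≤ d) (π σ : Permutation′ d) where

  m : ℕ
  m = d ∸ q

  -- paper index i ∈ {1..m}  (i as Fin m, 0-based) ↦ coordinate i of {1..d}
  leftIx : Fin m → Fin d
  leftIx i = inject≤ i (m∸n≤m d q)

  -- paper index j ∈ {q+1..d}, written j = q + j' with j' ∈ {1..m}  ↦ coordinate j
  rightIx : Fin m → Fin d
  rightIx j = cast (m+[n∸m]≡n q≤d) (q ↑ʳ j)

  InLeft : (Fin m → Bool) → Node d → Set
  InLeft b (ℓ , x) = (m ≤ ℓ) × (ℓ ≤ d) × (∀ i → x (π ⟨$⟩ʳ leftIx i) ≡ b i)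

  InRight : (Fin m → Bool) → Node d → Set
  InRight c (ℓ , x) = (d ≤ ℓ) × (ℓ ≤ d + q) × (∀ j → x (σ ⟨$⟩ʳ rightIx j) ≡ c j)

  Adjacent : (Fin m → Bool) → (Fin m → Bool) → Set
  Adjacent b c = ∃ λ (x : Label d) → InLeft b (d , x) × InRight c (d , x)

  Vertex : Set
  Vertex = (Fin m → Bool) ⊎ (Fin m → Bool)

  Edge : Vertex → Vertex → Set
  Edge (inj₁ b) (inj₂ c) = Adjacent b c
  Edge (inj₂ c) (inj₁ b) = Adjacent b c
  Edge _ _ = ⊥

  Connected : Vertex → Vertex → Set
  Connected = Star Edge

  ComponentsCompleteBipartite : Set
  ComponentsCompleteBipartite =
    ∀ (b c : Fin m → Bool) → Connected (inj₁ b) (inj₂ c) → Adjacent b c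

module Submission where

open import Defs
open import Data.Nat using (ℕ; _≤_)
open import Data.Nat.Properties using (≤-refl; m≤m+n; m∸n≤m; m+[n∸m]≡n)
open import Data.Fin using (Fin; cast; _↑ʳ_; _≟_)
open import Data.Fin.Properties using (any?; inject≤-injective; ↑ʳ-injective; cast-involutive)
open import Data.Fin.Permutation using (Permutation′; _⟨$⟩ʳ_)
open import Data.Bool using (Bool; false)
open import Data.Product using (_×_; ∃; _,_)
open import Data.Sum using (_⊎_; inj₁; inj₂)
open import Data.Empty using (⊥-elim)
open import Function using (_∘_)
open import Function.Bundles using (Injection)
open import Function.Definitions using (Injective)
open import Function.Properties.Inverse using (↔⇒↣)
open import Relation.Nullary using (Dec; yes; no)
open import Relation.Binary.Definitions using (DecidableEquality)
open import Relation.Binary.PropositionalEquality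
open import Relation.Binary.Construct.Closure.ReflexiveTransitive using (Star; fold)

-- The left sub-butterfly b* fixes the coordinates π(1), …, π(m) of the layer-d labels to b,
-- the right sub-butterfly *c fixes the coordinates σ(q+1), …, σ(d) to c, and all other
-- coordinates are free.  So b* and *c meet on layer d iff b and c agree on the coordinates
-- fixed by both.  Adjacent vertices thus induce the same values on these common coordinates,
-- hence so do all vertices of a component, and any left and right vertex of a component are
-- adjacent.

Agree : ∀ {a n} {K : Set} (f : Fin a → K) (g : Fin n → K) →
        (Fin a → Bool) → (Fin n → Bool) → Set
Agree f g b c = ∀ i j → f i ≡ g j → b i ≡ c j

module _ {a n} {K : Set} (_≟_ : DecidableEquality K)
         {f : Fin a → K} {g : Fin n → K}
         (f-injective : Injective _≡_ _≡_ f) (g-injective : Injective _≡_ _≡_ g) where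

  glue : ∀ {b c} → Agree f g b c →
         ∃ λ (x : K → Bool) → (∀ i → x (f i) ≡ b i) × (∀ j → x (g j) ≡ c j)
  glue {b} {c} agree = x , x∘f≗b , x∘g≗c
    where
    pick : ∀ {k} → Dec (∃ λ i → f i ≡ k) → Dec (∃ λ j → g j ≡ k) → Bool
    pick (yes (i , _)) _            = b i
    pick (no _)        (yes (j , _)) = c j
    pick (no _)        (no _)        = false

    x : K → Bool
    x k = pick (any? (λ i → f i ≟ k)) (any? (λ j → g j ≟ k))

    pick-f : ∀ i {k} (inF : Dec (∃ λ i → f i ≡ k)) inG → f i ≡ k → pick inF inG ≡ b i
    pick-f i (yes (i′ , fi′≡k)) _ fi≡k = cong b (f-injective (trans fi′≡k (sym fi≡k)))
    pick-f i (no ∉F)            _ fi≡k = ⊥-elim (∉F (i , fi≡k))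

    pick-g : ∀ j {k} (inF : Dec (∃ λ i → f i ≡ k)) inG → g j ≡ k → pick inF inG ≡ c j
    pick-g j (yes (i , fi≡k)) _                   gj≡k = agree i j (trans fi≡k (sym gj≡k))
    pick-g j (no _)           (yes (j′ , gj′≡k)) gj≡k = cong c (g-injective (trans gj′≡k (sym gj≡k)))
    pick-g j (no _)           (no ∉G)             gj≡k = ⊥-elim (∉G (j , gj≡k))

    x∘f≗b : ∀ i → x (f i) ≡ b i
    x∘f≗b i = pick-f i (any? (λ i′ → f i′ ≟ f i)) (any? (λ j → g j ≟ f i)) refl

    x∘g≗c : ∀ j → x (g j) ≡ c j
    x∘g≗c j = pick-g j (any? (λ i → f i ≟ g j)) (any? (λ j′ → g j′ ≟ g j)) refl

module SameOnOverlap {a n} {K : Set} (f : Fin a → K) (g : Fin n → K) where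

  valueAt : (Fin a → Bool) ⊎ (Fin n → Bool) → Fin a → Fin n → Bool
  valueAt (inj₁ b) i _ = b i
  valueAt (inj₂ c) _ j = c j

  _≈_ : (v w : (Fin a → Bool) ⊎ (Fin n → Bool)) → Set
  v ≈ w = ∀ i j → f i ≡ g j → valueAt v i j ≡ valueAt w i j

  star⇒≈ : {R : (v w : (Fin a → Bool) ⊎ (Fin n → Bool)) → Set} →
           (∀ {v w} → R v w → v ≈ w) → ∀ {v w} → Star R v w → v ≈ w
  star⇒≈ R⇒≈ = fold _≈_ (λ vRu u≈w i j e → trans (R⇒≈ vRu i j e) (u≈w i j e))
                        (λ _ _ _ → refl)

module _ (d q : ℕ) (q≤d : q ≤ d) (π σ : Permutation′ d) where

  open SubButterflies d q q≤d π σ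

  ⟨$⟩ʳ-injective : (ρ : Permutation′ d) → Injective _≡_ _≡_ (ρ ⟨$⟩ʳ_)
  ⟨$⟩ʳ-injective ρ = Injection.injective (↔⇒↣ ρ)

  leftIx-injective : Injective _≡_ _≡_ leftIx
  leftIx-injective = inject≤-injective _ _ _ _

  rightIx-injective : Injective _≡_ _≡_ rightIx
  rightIx-injective {i} {j} e = ↑ʳ-injective q i j (begin
    q ↑ʳ i                          ≡⟨ cast-involutive eq⁻¹ eq (q ↑ʳ i) ⟨
    cast eq⁻¹ (cast eq (q ↑ʳ i))    ≡⟨ cong (cast eq⁻¹) e ⟩
    cast eq⁻¹ (cast eq (q ↑ʳ j))    ≡⟨ cast-involutive eq⁻¹ eq (q ↑ʳ j) ⟩
    q ↑ʳ j                          ∎)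
    where
    open ≡-Reasoning
    eq = m+[n∸m]≡n q≤d
    eq⁻¹ = sym eq

  leftCoord rightCoord : Fin m → Fin d
  leftCoord i = π ⟨$⟩ʳ leftIx i
  rightCoord j = σ ⟨$⟩ʳ rightIx j

  adjacent⇒agree : ∀ {b c} → Adjacent b c → Agree leftCoord rightCoord b c
  adjacent⇒agree (x , (_ , _ , xl≗b) , (_ , _ , xr≗c)) i j l≡r =
    trans (sym (xl≗b i)) (trans (cong x l≡r) (xr≗c j))

  agree⇒adjacent : ∀ {b c} → Agree leftCoord rightCoord b c → Adjacent b c
  agree⇒adjacent agree =
    let x , xl≗b , xr≗c = glue _≟_ (leftIx-injective ∘ ⟨$⟩ʳ-injective π)
                                   (rightIx-injective ∘ ⟨$⟩ʳ-injective σ) agree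
    in x , (m∸n≤m d q , ≤-refl , xl≗b) , (≤-refl , m≤m+n d q , xr≗c)

  open SameOnOverlap leftCoord rightCoord

  edge⇒≈ : ∀ {v w} → Edge v w → v ≈ w
  edge⇒≈ {inj₁ _} {inj₂ _} adj = adjacent⇒agree adj
  edge⇒≈ {inj₂ _} {inj₁ _} adj i j e = sym (adjacent⇒agree adj i j e)

lemma3 : (d q : ℕ) (q≤d : q ≤ d) (π σ : Permutation′ d) →
           SubButterflies.ComponentsCompleteBipartite d q q≤d π σ
lemma3 d q q≤d π σ b c connected =
  agree⇒adjacent d q q≤d π σ (SameOnOverlap.star⇒≈ _ _ (edge⇒≈ d q q≤d π σ) connected)
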